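{- Let $F$ be a finite simple graph and let $R$ be a nonempty set of pendant edges of $F$. If the rooted graph $L(F)_R$ admits a valid decomposition $\mathcal{D}$, then $\mathcal{D}$ contains at least one edge part.
   Context: $L(F)$ is the line graph of $F$ and $L(F)_R$ is it with root set $R$. A pendant edge is an edge with an endpoint of degree $1$. A valid decomposition of a rooted graph $G_R$ is a partition of $E(G)$ into parts each a triangle or a single edge (an edge part), identified with vertex sets, such that every non-root vertex lies in exactly $3$ parts and every root in exactly $2$ parts. -}

module Defs where

open import Data.Nat using (ℕ; zero; suc; _+_; _<_)
open import Data.Fin using (Fin; toℕ)
open import Data.Fin.Properties using () renaming (_≟_ to _≟ᶠ_)
open import Data.Bool using (Bool; true; false; if_then_else_)
open import Data.List using (List; []; _∷_; map; allFin)
open import Data.Nat.ListAction using (sum)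
open import Data.List.Membership.Propositional using (_∈_)
open import Data.List.Relation.Unary.Any using (Any)
open import Data.Product using (Σ; ∃; ∃-syntax; _×_; _,_)
open import Data.Product.Properties using (≡-dec)
open import Data.Sum using (_⊎_)
open import Relation.Binary.PropositionalEquality using (_≡_; _≢_)
open import Relation.Nullary using (¬_; Dec; yes; no)

record SimpleGraph (n : ℕ) : Set where
  field
    adj   : Fin n → Fin n → Bool
    sym   : ∀ u v → adj u v ≡ adj v u
    irrefl : ∀ u → adj u u ≡ false
open SimpleGraph public

-- An edge {u,v} of F is represented canonically as the pair (u , v) with u < v.
Pair : ℕ → Set
Pair n = Fin n × Fin n

_≟ₚ_ : ∀ {n} (p q : Pair n) → Dec (p ≡ q)
_≟ₚ_ = ≡-dec _≟ᶠ_ _≟ᶠ_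

IsEdge : ∀ {n} → SimpleGraph n → Pair n → Set
IsEdge F (u , v) = (toℕ u < toℕ v) × (adj F u v ≡ true)

degree : ∀ {n} → SimpleGraph n → Fin n → ℕ
degree {n} F u = sum (map (λ w → if adj F u w then 1 else 0) (allFin n))

IsPendant : ∀ {n} → SimpleGraph n → Pair n → Set
IsPendant F (u , v) = IsEdge F (u , v) × ((degree F u ≡ 1) ⊎ (degree F v ≡ 1))

SharesEndpoint : ∀ {n} → Pair n → Pair n → Set
SharesEndpoint (a , b) (c , d) = (a ≡ c) ⊎ (a ≡ d) ⊎ (b ≡ c) ⊎ (b ≡ d)

LAdj : ∀ {n} → SimpleGraph n → Pair n → Pair n → Set
LAdj F e f = IsEdge F e × IsEdge F f × (e ≢ f) × SharesEndpoint e f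

-- A part of a decomposition, identified with its vertex set.
data Part (V : Set) : Set where
  edgeP : V → V → Part V
  triP  : V → V → V → Part V

ValidPart : ∀ {n} → SimpleGraph n → Part (Pair n) → Set
ValidPart F (edgeP x y)  = LAdj F x y
ValidPart F (triP x y z) = LAdj F x y × LAdj F y z × LAdj F x z

inPart : ∀ {n} → Pair n → Part (Pair n) → Bool
inPart v (edgeP x y) with v ≟ₚ x | v ≟ₚ y
... | no _ | no _ = false
... | _    | _    = true
inPart v (triP x y z) with v ≟ₚ x | v ≟ₚ y | v ≟ₚ z
... | no _ | no _ | no _ = false
... | _    | _    | _    = true

vcount : ∀ {n} → Pair n → List (Part (Pair n)) → ℕ
vcount v [] = 0
vcount v (p ∷ D) = (if inPart v p then 1 else 0) + vcount v D

ecount : ∀ {n} → Pair n → Pair n → List (Part (Pair n)) → ℕ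
ecount x y [] = 0
ecount x y (p ∷ D) = (if inPart x p then (if inPart y p then 1 else 0) else 0) + ecount x y D

record ValidDecomposition {n} (F : SimpleGraph n) (R : List (Pair n))
                          (D : List (Part (Pair n))) : Set where
  field
    partsValid : ∀ p → p ∈ D → ValidPart F p
    partition  : ∀ x y → LAdj F x y → ecount x y D ≡ 1
    nonRoot3   : ∀ v → IsEdge F v → ¬ (v ∈ R) → vcount v D ≡ 3
    root2      : ∀ v → IsEdge F v → v ∈ R → vcount v D ≡ 2

{-# OPTIONS --safe #-}
-- Suppose every part is a triangle and let r = uv ∈ R with deg u = 1. The
-- neighbours of r in L(F) are the "spokes" vx with x ≠ u, so the two parts at r
-- are triangles {r,a,b} and {r,c,d} of spokes, meeting only in r. For spokes
-- y ∈ {a,b} and z ∈ {c,d} the part covering yz cannot contain a third edge at v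
-- (it would share two vertices with a part at r), so it is {y, z, x_y x_z},
-- x_y and x_z being the tips. Hence a and c are not pendant, and their three
-- parts are {r,a,b}, {a,c,x_a x_c}, {a,d,x_a x_d} and {r,c,d}, {a,c,x_a x_c},
-- {b,c,x_b x_c}. The third vertex q of the part covering x_a x_c and x_a x_d
-- meets both edges, so it passes through x_a or equals x_c x_d; either way q is
-- a neighbour of a, resp. c, in none of its parts.

module Submission where

open import Defs hiding (sym)
open import Data.Nat using (ℕ; suc; _≤_; z≤n; s≤s)
open import Data.Fin using (Fin) renaming (_≟_ to _≟ᶠ_)
open import Data.Nat.Properties using (≤-refl; ≤-trans; ≤-reflexive; n≤1+n; 1+n≰n; <-asym; <-irrefl; module ≤-Reasoning)
open import Data.Nat.ListAction using (sum)
open import Data.Bool using (Bool; true; false; T; if_then_else_)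
open import Data.Unit using (tt)
open import Data.List using (List; []; _∷_; length; filter; filterᵇ; map; allFin)
open import Data.List.Properties using (length-removeAt′; filter-accept; filter-some)
open import Data.List.Membership.Propositional using (_∈_; _∉_; _─_; lose)
open import Data.List.Membership.Propositional.Properties using (∈-filter⁺; ∈-filter⁻; ∈-allFin)
open import Data.List.Relation.Unary.Any using (Any; here; there; any?)
open import Data.List.Relation.Unary.All using (All; []; _∷_; lookup)
open import Data.List.Relation.Unary.All.Properties using (¬Any⇒All¬)
open import Data.List.Relation.Unary.AllPairs using ([]; _∷_)
open import Data.List.Relation.Unary.Unique.Propositional using (Unique)
open import Data.List.Relation.Unary.Unique.Propositional.Properties using (filter⁺)
open import Data.List.Relation.Binary.Subset.Propositional using (_⊆_)
open import Data.Product using (∃-syntax; _×_; _,_; proj₁; proj₂)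
open import Data.Sum using (_⊎_; inj₁; inj₂; [_,_]′; swap)
open import Data.Empty using (⊥; ⊥-elim)
open import Relation.Binary.PropositionalEquality using (_≡_; _≢_; refl; sym; trans; cong; subst)
open import Relation.Nullary using (¬_; Dec; yes; no; does; _×-dec_)
open import Relation.Nullary.Decidable using (map′; T?; decidable-stable)
open import Function using (_∘_; case_of_)
open import Relation.Unary using (Decidable)

module _ {A : Set} where

  ∈-─ : ∀ {x y : A} {zs} (y∈zs : y ∈ zs) → x ∈ zs → x ≢ y → x ∈ zs ─ y∈zs
  ∈-─ (here refl) (here refl) x≢y = ⊥-elim (x≢y refl)
  ∈-─ (here refl) (there x∈zs) _  = x∈zs
  ∈-─ (there _)   (here refl)  _  = here refl
  ∈-─ (there y∈zs) (there x∈zs) x≢y = there (∈-─ y∈zs x∈zs x≢y)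

  Unique-⊆⇒length-≤ : ∀ {ys zs : List A} → Unique ys → ys ⊆ zs → length ys ≤ length zs
  Unique-⊆⇒length-≤ [] _ = z≤n
  Unique-⊆⇒length-≤ {y ∷ ys} {zs} (y≢ys ∷ ys!) y∷ys⊆zs =
    subst (suc (length ys) ≤_) (sym (length-removeAt′ zs _))
      (s≤s (Unique-⊆⇒length-≤ ys! ys⊆zs─y))
    where
    ys⊆zs─y : ys ⊆ zs ─ y∷ys⊆zs (here refl)
    ys⊆zs─y x∈ys = ∈-─ _ (y∷ys⊆zs (there x∈ys)) (λ x≡y → lookup y≢ys x∈ys (sym x≡y))

  Unique-⊆-saturated : ∀ {ys zs : List A} {z} → Unique ys → ys ⊆ zs → length zs ≤ length ys →
                       z ∈ zs → ¬ z ∉ ys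
  Unique-⊆-saturated {ys} ys! ys⊆zs zs≤ys z∈zs z∉ys =
    1+n≰n (≤-trans (Unique-⊆⇒length-≤ (¬Any⇒All¬ ys z∉ys ∷ ys!) z∷ys⊆zs) zs≤ys)
    where
    z∷ys⊆zs : _ ⊆ _
    z∷ys⊆zs (here refl)   = z∈zs
    z∷ys⊆zs (there x∈ys) = ys⊆zs x∈ys

  length-filter-∷ : ∀ {P : A → Set} (P? : Decidable P) x xs →
                    length (filter P? xs) ≤ length (filter P? (x ∷ xs))
  length-filter-∷ P? x xs with does (P? x)
  ... | true  = n≤1+n _
  ... | false = ≤-refl

  Unique-if-singled-out : ∀ {I : Set} {P : I → A → Set} (P? : ∀ i → Decidable (P i)) xs →
    (∀ {x} → x ∈ xs → ∃[ i ] P i x × length (filter (P? i) xs) ≤ 1) → Unique xs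
  Unique-if-singled-out P? [] _ = []
  Unique-if-singled-out {P = P} P? (x ∷ xs) singled = x∉xs ∷ Unique-if-singled-out P? xs singled-in-xs
    where
    x∉xs : All (x ≢_) xs
    x∉xs = ¬Any⇒All¬ xs λ x∈xs →
      let (i , Pix , ≤1) = singled (here refl)
          open ≤-Reasoning
      in  1+n≰n (begin
            2                                ≤⟨ s≤s (filter-some (P? i) (lose x∈xs Pix)) ⟩
            suc (length (filter (P? i) xs))  ≡⟨ cong length (filter-accept (P? i) Pix) ⟨
            length (filter (P? i) (x ∷ xs))  ≤⟨ ≤1 ⟩
            1                                ∎)
    singled-in-xs : ∀ {y} → y ∈ xs → ∃[ i ] P i y × length (filter (P? i) xs) ≤ 1
    singled-in-xs y∈xs =
      let (i , Piy , ≤1) = singled (there y∈xs)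
      in  i , Piy , ≤-trans (length-filter-∷ (P? i) x xs) ≤1

  length≡1⇒∃∈ : ∀ {xs : List A} → length xs ≡ 1 → ∃[ x ] x ∈ xs
  length≡1⇒∃∈ {xs = x ∷ []} refl = x , here refl

  length≡1⇒∈-unique : ∀ {xs : List A} {x y} → length xs ≡ 1 → x ∈ xs → y ∈ xs → x ≡ y
  length≡1⇒∈-unique {xs = _ ∷ []} refl (here refl) (here refl) = refl

  sum-indicator≡length-filterᵇ : ∀ (b : A → Bool) xs →
                                 sum (map (λ x → if b x then 1 else 0) xs) ≡ length (filterᵇ b xs)
  sum-indicator≡length-filterᵇ b []       = refl
  sum-indicator≡length-filterᵇ b (x ∷ xs) with b x
  ... | true  = cong suc (sum-indicator≡length-filterᵇ b xs)
  ... | false = sum-indicator≡length-filterᵇ b xs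

module _ {n : ℕ} where

  infix 4 _∈ₚ_ _∈ₚ?_

  _∈ₚ_ : Pair n → Part (Pair n) → Set
  x ∈ₚ p = T (inPart x p)

  _∈ₚ?_ : ∀ x p → Dec (x ∈ₚ p)
  x ∈ₚ? p = T? (inPart x p)

  ∈ₚ-triP⁺ : ∀ {w x y z} → w ≡ x ⊎ w ≡ y ⊎ w ≡ z → w ∈ₚ triP x y z
  ∈ₚ-triP⁺ {w} {x} {y} {z} w∈xyz with w ≟ₚ x | w ≟ₚ y | w ≟ₚ z
  ... | yes _  | _      | _      = tt
  ... | no _   | yes _  | _      = tt
  ... | no _   | no _   | yes _  = tt
  ... | no w≢x | no w≢y | no w≢z = [ w≢x , [ w≢y , w≢z ]′ ]′ w∈xyz

  ∈ₚ-triP⁻ : ∀ {w x y z} → w ∈ₚ triP x y z → w ≡ x ⊎ w ≡ y ⊎ w ≡ z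
  ∈ₚ-triP⁻ {w} {x} {y} {z} w∈xyz with w ≟ₚ x | w ≟ₚ y | w ≟ₚ z
  ... | yes w≡x | _       | _       = inj₁ w≡x
  ... | no _    | yes w≡y | _       = inj₂ (inj₁ w≡y)
  ... | no _    | no _    | yes w≡z = inj₂ (inj₂ w≡z)

  partsAt : Pair n → List (Part (Pair n)) → List (Part (Pair n))
  partsAt x = filter (x ∈ₚ?_)

  partsAt₂ : Pair n → Pair n → List (Part (Pair n)) → List (Part (Pair n))
  partsAt₂ x y = filter (λ p → x ∈ₚ? p ×-dec y ∈ₚ? p)

  vcount≡length-partsAt : ∀ x D → vcount x D ≡ length (partsAt x D)
  vcount≡length-partsAt x []      = refl
  vcount≡length-partsAt x (p ∷ D) with inPart x p
  ... | true  = cong suc (vcount≡length-partsAt x D)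
  ... | false = vcount≡length-partsAt x D

  ecount≡length-partsAt₂ : ∀ x y D → ecount x y D ≡ length (partsAt₂ x y D)
  ecount≡length-partsAt₂ x y []      = refl
  ecount≡length-partsAt₂ x y (p ∷ D) with inPart x p | inPart y p
  ... | true  | true  = cong suc (ecount≡length-partsAt₂ x y D)
  ... | true  | false = ecount≡length-partsAt₂ x y D
  ... | false | _     = ecount≡length-partsAt₂ x y D

module _ {n : ℕ} where

  infix 4 _∈ᵉ_

  _∈ᵉ_ : Fin n → Pair n → Set
  w ∈ᵉ e = w ≡ proj₁ e ⊎ w ≡ proj₂ e

  Joins : Pair n → Fin n → Fin n → Set
  Joins e s t = e ≡ (s , t) ⊎ e ≡ (t , s)

  Joins-sym : ∀ {e s t} → Joins e s t → Joins e t s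
  Joins-sym = swap

  Joins-∈ᵉ : ∀ {e s t} → Joins e s t → s ∈ᵉ e
  Joins-∈ᵉ (inj₁ refl) = inj₁ refl
  Joins-∈ᵉ (inj₂ refl) = inj₂ refl

  Joins-∈ᵉ⁻ : ∀ {e s t w} → Joins e s t → w ∈ᵉ e → w ≡ s ⊎ w ≡ t
  Joins-∈ᵉ⁻ (inj₁ refl) w∈e = w∈e
  Joins-∈ᵉ⁻ (inj₂ refl) w∈e = swap w∈e

  ∈ᵉ-Joins : ∀ {e s t} → s ∈ᵉ e → t ∈ᵉ e → s ≢ t → Joins e s t
  ∈ᵉ-Joins (inj₁ refl) (inj₁ refl) s≢t = ⊥-elim (s≢t refl)
  ∈ᵉ-Joins (inj₁ refl) (inj₂ refl) _   = inj₁ refl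
  ∈ᵉ-Joins (inj₂ refl) (inj₁ refl) _   = inj₂ refl
  ∈ᵉ-Joins (inj₂ refl) (inj₂ refl) s≢t = ⊥-elim (s≢t refl)

  ∈ᵉ⇒Joins : ∀ {e w} → w ∈ᵉ e → ∃[ t ] Joins e w t
  ∈ᵉ⇒Joins (inj₁ refl) = _ , inj₁ refl
  ∈ᵉ⇒Joins (inj₂ refl) = _ , inj₂ refl

  Joins-injʳ : ∀ {e s t t′} → Joins e s t → Joins e s t′ → t ≡ t′
  Joins-injʳ (inj₁ refl) (inj₁ refl) = refl
  Joins-injʳ (inj₁ refl) (inj₂ refl) = refl
  Joins-injʳ (inj₂ refl) (inj₁ refl) = refl
  Joins-injʳ (inj₂ refl) (inj₂ refl) = refl

  SharesEndpoint⇒∈ᵉ : ∀ {e f} → SharesEndpoint e f → ∃[ w ] w ∈ᵉ e × w ∈ᵉ f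
  SharesEndpoint⇒∈ᵉ (inj₁ refl)               = _ , inj₁ refl , inj₁ refl
  SharesEndpoint⇒∈ᵉ (inj₂ (inj₁ refl))        = _ , inj₁ refl , inj₂ refl
  SharesEndpoint⇒∈ᵉ (inj₂ (inj₂ (inj₁ refl))) = _ , inj₂ refl , inj₁ refl
  SharesEndpoint⇒∈ᵉ (inj₂ (inj₂ (inj₂ refl))) = _ , inj₂ refl , inj₂ refl

  ∈ᵉ⇒SharesEndpoint : ∀ {e f w} → w ∈ᵉ e → w ∈ᵉ f → SharesEndpoint e f
  ∈ᵉ⇒SharesEndpoint (inj₁ refl) (inj₁ refl) = inj₁ refl
  ∈ᵉ⇒SharesEndpoint (inj₁ refl) (inj₂ refl) = inj₂ (inj₁ refl)
  ∈ᵉ⇒SharesEndpoint (inj₂ refl) (inj₁ refl) = inj₂ (inj₂ (inj₁ refl))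
  ∈ᵉ⇒SharesEndpoint (inj₂ refl) (inj₂ refl) = inj₂ (inj₂ (inj₂ refl))

  SharesEndpoint-sym : ∀ {e f} → SharesEndpoint e f → SharesEndpoint f e
  SharesEndpoint-sym shared with SharesEndpoint⇒∈ᵉ shared
  ... | _ , w∈e , w∈f = ∈ᵉ⇒SharesEndpoint w∈f w∈e

  meets-cherry : ∀ {e₁ e₂ q s t₁ t₂} → Joins e₁ s t₁ → Joins e₂ s t₂ → t₁ ≢ t₂ →
                 SharesEndpoint q e₁ → SharesEndpoint q e₂ → s ∈ᵉ q ⊎ Joins q t₁ t₂
  meets-cherry e₁-joins e₂-joins t₁≢t₂ q-e₁ q-e₂
    with SharesEndpoint⇒∈ᵉ q-e₁ | SharesEndpoint⇒∈ᵉ q-e₂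
  ... | _ , w₁∈q , w₁∈e₁ | _ , w₂∈q , w₂∈e₂
    with Joins-∈ᵉ⁻ e₁-joins w₁∈e₁ | Joins-∈ᵉ⁻ e₂-joins w₂∈e₂
  ... | inj₁ refl | _         = inj₁ w₁∈q
  ... | inj₂ _    | inj₁ refl = inj₁ w₂∈q
  ... | inj₂ refl | inj₂ refl = inj₂ (∈ᵉ-Joins w₁∈q w₂∈q t₁≢t₂)

module _ {n : ℕ} (F : SimpleGraph n) where

  Joins-unique : ∀ {e f s t} → IsEdge F e → IsEdge F f → Joins e s t → Joins f s t → e ≡ f
  Joins-unique _        _         (inj₁ refl) (inj₁ refl) = refl
  Joins-unique (s<t , _) (t<s , _) (inj₁ refl) (inj₂ refl) = ⊥-elim (<-asym s<t t<s)
  Joins-unique (t<s , _) (s<t , _) (inj₂ refl) (inj₁ refl) = ⊥-elim (<-asym s<t t<s)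
  Joins-unique _        _         (inj₂ refl) (inj₂ refl) = refl

  IsEdge-adj : ∀ {e s t} → IsEdge F e → Joins e s t → adj F s t ≡ true
  IsEdge-adj (_ , st) (inj₁ refl) = st
  IsEdge-adj (_ , ts) (inj₂ refl) = trans (SimpleGraph.sym F _ _) ts

  IsEdge-≢ : ∀ {e s t} → IsEdge F e → Joins e s t → s ≢ t
  IsEdge-≢ (s<s , _) (inj₁ refl) refl = <-irrefl refl s<s
  IsEdge-≢ (s<s , _) (inj₂ refl) refl = <-irrefl refl s<s

  degree≡1⇒unique-neighbour : ∀ {w s t} → degree F w ≡ 1 →
                              adj F w s ≡ true → adj F w t ≡ true → s ≡ t
  degree≡1⇒unique-neighbour {w} {s} {t} deg≡1 ws wt = decidable-stable (s ≟ᶠ t) λ s≢t →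
    1+n≰n (begin
      2                                      ≤⟨ Unique-⊆⇒length-≤ ((s≢t ∷ []) ∷ [] ∷ []) st⊆nbrs ⟩
      length (filterᵇ (adj F w) (allFin n))  ≡⟨ sum-indicator≡length-filterᵇ (adj F w) (allFin n) ⟨
      degree F w                             ≡⟨ deg≡1 ⟩
      1                                      ∎)
    where
    open ≤-Reasoning
    neighbour : ∀ {x} → adj F w x ≡ true → x ∈ filterᵇ (adj F w) (allFin n)
    neighbour wx = ∈-filter⁺ (T? ∘ adj F w) (∈-allFin _) (subst T (sym wx) tt)
    st⊆nbrs : s ∷ t ∷ [] ⊆ filterᵇ (adj F w) (allFin n)
    st⊆nbrs (here refl)         = neighbour ws
    st⊆nbrs (there (here refl)) = neighbour wt

  pendant-endpoint : ∀ {e} → IsPendant F e → ∃[ u ] ∃[ v ] Joins e u v × degree F u ≡ 1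
  pendant-endpoint (_ , inj₁ deg≡1) = _ , _ , inj₁ refl , deg≡1
  pendant-endpoint (_ , inj₂ deg≡1) = _ , _ , inj₂ refl , deg≡1

  IsPendant-Joins : ∀ {e s t} → IsPendant F e → Joins e s t → degree F s ≡ 1 ⊎ degree F t ≡ 1
  IsPendant-Joins (_ , deg≡1) (inj₁ refl) = deg≡1
  IsPendant-Joins (_ , deg≡1) (inj₂ refl) = swap deg≡1

module LineGraph {n : ℕ} (F : SimpleGraph n) where

  infix 4 _~_

  _~_ : Pair n → Pair n → Set
  _~_ = LAdj F

  ~-edgeʳ : ∀ {x y} → x ~ y → IsEdge F y
  ~-edgeʳ (_ , y-edge , _) = y-edge

  ~-≢ : ∀ {x y} → x ~ y → x ≢ y
  ~-≢ (_ , _ , x≢y , _) = x≢y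

  ~-shares : ∀ {x y} → x ~ y → SharesEndpoint x y
  ~-shares (_ , _ , _ , shared) = shared

  ~-sym : ∀ {x y} → x ~ y → y ~ x
  ~-sym (x-edge , y-edge , x≢y , shared) = y-edge , x-edge , x≢y ∘ sym , SharesEndpoint-sym shared

  record Triangle (P : Part (Pair n)) (x y z : Pair n) : Set where
    field
      members : ∀ {w} → w ∈ₚ P → w ≡ x ⊎ w ≡ y ⊎ w ≡ z
      x∈P     : x ∈ₚ P
      y∈P     : y ∈ₚ P
      z∈P     : z ∈ₚ P
      x~y     : x ~ y
      x~z     : x ~ z
      y~z     : y ~ z

  Triangle-triP : ∀ {x y z} → ValidPart F (triP x y z) → Triangle (triP x y z) x y z
  Triangle-triP (x~y , y~z , x~z) = record
    { members = ∈ₚ-triP⁻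
    ; x∈P = ∈ₚ-triP⁺ (inj₁ refl)
    ; y∈P = ∈ₚ-triP⁺ (inj₂ (inj₁ refl))
    ; z∈P = ∈ₚ-triP⁺ (inj₂ (inj₂ refl))
    ; x~y = x~y ; x~z = x~z ; y~z = y~z
    }

  Triangle-swap₁₂ : ∀ {P x y z} → Triangle P x y z → Triangle P y x z
  Triangle-swap₁₂ t = record
    { members = λ w∈P → [ inj₂ ∘ inj₁ , [ inj₁ , inj₂ ∘ inj₂ ]′ ]′ (members w∈P)
    ; x∈P = y∈P ; y∈P = x∈P ; z∈P = z∈P
    ; x~y = ~-sym x~y ; x~z = y~z ; y~z = x~z
    }
    where open Triangle t

  Triangle-swap₂₃ : ∀ {P x y z} → Triangle P x y z → Triangle P x z y
  Triangle-swap₂₃ t = record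
    { members = λ w∈P → [ inj₁ , [ inj₂ ∘ inj₂ , inj₂ ∘ inj₁ ]′ ]′ (members w∈P)
    ; x∈P = x∈P ; y∈P = z∈P ; z∈P = y∈P
    ; x~y = x~z ; x~z = x~y ; y~z = ~-sym y~z
    }
    where open Triangle t

module TriangleDecomposition {n : ℕ} {F : SimpleGraph n} {R : List (Pair n)} {D : List (Part (Pair n))}
                             (valid : ValidDecomposition F R D) (no-edge-part : ∀ {x y} → edgeP x y ∉ D) where

  open ValidDecomposition valid
  open LineGraph F

  part-triangle : ∀ {P} → P ∈ D → ∃[ x ] ∃[ y ] ∃[ z ] Triangle P x y z
  part-triangle {edgeP _ _}  P∈D = ⊥-elim (no-edge-part P∈D)
  part-triangle {triP x y z} P∈D = x , y , z , Triangle-triP (partsValid _ P∈D)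

  triangle-at : ∀ {P x} → P ∈ D → x ∈ₚ P → ∃[ y ] ∃[ z ] Triangle P x y z
  triangle-at P∈D x∈P with part-triangle P∈D
  ... | _ , y , z , t with Triangle.members t x∈P
  ... | inj₁ refl        = y , z , t
  ... | inj₂ (inj₁ refl) = _ , z , Triangle-swap₁₂ t
  ... | inj₂ (inj₂ refl) = _ , y , Triangle-swap₁₂ (Triangle-swap₂₃ t)

  triangle-through : ∀ {P x y} → P ∈ D → x ∈ₚ P → y ∈ₚ P → x ≢ y → ∃[ z ] Triangle P x y z
  triangle-through P∈D x∈P y∈P x≢y with triangle-at P∈D x∈P
  ... | y′ , z′ , t with Triangle.members t y∈P
  ... | inj₁ refl        = ⊥-elim (x≢y refl)
  ... | inj₂ (inj₁ refl) = z′ , t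
  ... | inj₂ (inj₂ refl) = y′ , Triangle-swap₂₃ t

  length-partsAt₂≡1 : ∀ {x y} → x ~ y → length (partsAt₂ x y D) ≡ 1
  length-partsAt₂≡1 {x} {y} x~y = trans (sym (ecount≡length-partsAt₂ x y D)) (partition x y x~y)

  covered : ∀ {x y} → x ~ y → ∃[ P ] P ∈ D × x ∈ₚ P × y ∈ₚ P
  covered x~y = let (P , P∈partsAt₂) = length≡1⇒∃∈ (length-partsAt₂≡1 x~y)
                in  P , ∈-filter⁻ _ P∈partsAt₂

  members-adjacent : ∀ {P x y} → P ∈ D → x ∈ₚ P → y ∈ₚ P → x ≢ y → x ~ y
  members-adjacent P∈D x∈P y∈P x≢y = Triangle.x~y (proj₂ (triangle-through P∈D x∈P y∈P x≢y))

  same-part : ∀ {P P′ x y} → P ∈ D → P′ ∈ D → x ≢ y →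
              x ∈ₚ P → y ∈ₚ P → x ∈ₚ P′ → y ∈ₚ P′ → P ≡ P′
  same-part P∈D P′∈D x≢y x∈P y∈P x∈P′ y∈P′ =
    length≡1⇒∈-unique (length-partsAt₂≡1 (members-adjacent P∈D x∈P y∈P x≢y))
                      (∈-filter⁺ _ P∈D (x∈P , y∈P)) (∈-filter⁺ _ P′∈D (x∈P′ , y∈P′))

  Unique-D : Unique D
  Unique-D = Unique-if-singled-out covers? D singled-out
    where
    Covers : (∃[ x ] ∃[ y ] x ~ y) → Part (Pair n) → Set
    Covers (x , y , _) P = x ∈ₚ P × y ∈ₚ P
    covers? : ∀ i P → Dec (Covers i P)
    covers? (x , y , _) P = x ∈ₚ? P ×-dec y ∈ₚ? P
    singled-out : ∀ {P} → P ∈ D → ∃[ i ] Covers i P × length (filter (covers? i) D) ≤ 1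
    singled-out P∈D with part-triangle P∈D
    ... | x , y , _ , t = (x , y , x~y) , (x∈P , y∈P) , ≤-reflexive (length-partsAt₂≡1 x~y)
      where open Triangle t

  -- membership up to double negation, which is what counting gives without deciding equality of parts
  Exhausts : Pair n → List (Part (Pair n)) → Set
  Exhausts x Ps = ∀ {P} → P ∈ D → x ∈ₚ P → ¬ P ∉ Ps

  neighbour-in-some-part : ∀ {x q Ps} → Exhausts x Ps → x ~ q → Any (q ∈ₚ_) Ps
  neighbour-in-some-part {q = q} {Ps} exhausts x~q with covered x~q
  ... | W , W∈D , x∈W , q∈W = decidable-stable (any? (q ∈ₚ?_) Ps) λ q∉Ps →
    exhausts W∈D x∈W λ W∈Ps → q∉Ps (lose W∈Ps q∈W)

  saturated⇒Exhausts : ∀ {x Ps} → vcount x D ≡ length Ps → Unique Ps →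
                       All (λ P → P ∈ D × x ∈ₚ P) Ps → Exhausts x Ps
  saturated⇒Exhausts {x} count Ps! Ps-at-x P∈D x∈P =
    Unique-⊆-saturated Ps! Ps⊆partsAt (≤-reflexive (trans (sym (vcount≡length-partsAt x D)) count))
                       (∈-filter⁺ (x ∈ₚ?_) P∈D x∈P)
    where
    Ps⊆partsAt : _ ⊆ partsAt x D
    Ps⊆partsAt P∈Ps = let (P∈D , x∈P) = lookup Ps-at-x P∈Ps in ∈-filter⁺ (x ∈ₚ?_) P∈D x∈P

  record TwoPartsAt (x : Pair n) : Set where
    field
      T₁ T₂   : Part (Pair n)
      T₁∈D    : T₁ ∈ D
      T₂∈D    : T₂ ∈ D
      T₁≢T₂   : T₁ ≢ T₂
      x∈T₁    : x ∈ₚ T₁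
      x∈T₂    : x ∈ₚ T₂
      only    : ∀ {P} → P ∈ D → x ∈ₚ P → P ≡ T₁ ⊎ P ≡ T₂

  two-parts-at : ∀ {x} → vcount x D ≡ 2 → TwoPartsAt x
  two-parts-at {x} count
    with partsAt x D | filter⁺ (x ∈ₚ?_) Unique-D | (λ {P} → ∈-filter⁻ (x ∈ₚ?_) {P} {D})
       | (λ {P} → ∈-filter⁺ (x ∈ₚ?_) {P} {D}) | trans (sym count) (vcount≡length-partsAt x D)
  ... | T₁ ∷ T₂ ∷ [] | (T₁≢T₂ ∷ []) ∷ _ | ∈⁻ | ∈⁺ | refl = record
    { T₁∈D = proj₁ (∈⁻ (here refl)) ; T₂∈D = proj₁ (∈⁻ (there (here refl)))
    ; T₁≢T₂ = T₁≢T₂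
    ; x∈T₁ = proj₂ (∈⁻ (here refl)) ; x∈T₂ = proj₂ (∈⁻ (there (here refl)))
    ; only = λ P∈D x∈P → case ∈⁺ P∈D x∈P of λ where
        (here P≡T₁)         → inj₁ P≡T₁
        (there (here P≡T₂)) → inj₂ P≡T₂
    }

  TwoPartsAt-swap : ∀ {x} → TwoPartsAt x → TwoPartsAt x
  TwoPartsAt-swap parts = record
    { T₁∈D = T₂∈D ; T₂∈D = T₁∈D ; T₁≢T₂ = T₁≢T₂ ∘ sym
    ; x∈T₁ = x∈T₂ ; x∈T₂ = x∈T₁
    ; only = λ P∈D x∈P → swap (only P∈D x∈P)
    }
    where open TwoPartsAt parts

module PendantRoot {n : ℕ} {F : SimpleGraph n} {R : List (Pair n)} {D : List (Part (Pair n))}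
                   (pendant : All (IsPendant F) R)
                   (valid : ValidDecomposition F R D) (no-edge-part : ∀ {x y} → edgeP x y ∉ D)
                   {r : Pair n} {u v : Fin n} (r∈R : r ∈ R) (r-edge : IsEdge F r) (r-joins : Joins r u v)
                   (deg-u≡1 : degree F u ≡ 1) where

  open ValidDecomposition valid
  open LineGraph F
  open TriangleDecomposition valid no-edge-part

  record Spoke (y : Pair n) (x : Fin n) : Set where
    field
      edge  : IsEdge F y
      joins : Joins y v x
      x≢u   : x ≢ u

  open Spoke

  tip≢v : ∀ {y x} → Spoke y x → x ≢ v
  tip≢v s = IsEdge-≢ F (edge s) (joins s) ∘ sym

  neighbour-spoke : ∀ {y} → r ~ y → ∃[ x ] Spoke y x
  neighbour-spoke (_ , y-edge , r≢y , shared) with SharesEndpoint⇒∈ᵉ shared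
  ... | w , w∈r , w∈y with Joins-∈ᵉ⁻ r-joins w∈r | ∈ᵉ⇒Joins w∈y
  ... | inj₁ refl | t , y-joins =
    ⊥-elim (r≢y (Joins-unique F r-edge y-edge r-joins (subst (Joins _ u) t≡v y-joins)))
    where
    t≡v = degree≡1⇒unique-neighbour F deg-u≡1 (IsEdge-adj F y-edge y-joins) (IsEdge-adj F r-edge r-joins)
  ... | inj₂ refl | t , y-joins = t , record { edge = y-edge ; joins = y-joins ; x≢u = t≢u }
    where
    t≢u : t ≢ u
    t≢u refl = r≢y (Joins-unique F r-edge y-edge r-joins (Joins-sym y-joins))

  spoke-unique : ∀ {y z x} → Spoke y x → IsEdge F z → Joins z v x → z ≡ y
  spoke-unique s z-edge z-joins = Joins-unique F z-edge (edge s) z-joins (joins s)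

  spokes-adjacent : ∀ {y z x x′} → Spoke y x → Spoke z x′ → y ≢ z → y ~ z
  spokes-adjacent sy sz y≢z =
    edge sy , edge sz , y≢z , ∈ᵉ⇒SharesEndpoint (Joins-∈ᵉ (joins sy)) (Joins-∈ᵉ (joins sz))

  spokes-distinct-tips : ∀ {y z x x′} → Spoke y x → Spoke z x′ → y ≢ z → x ≢ x′
  spokes-distinct-tips sy sz y≢z refl = y≢z (sym (spoke-unique sy (edge sz) (joins sz)))

  spoke-neighbour-tip : ∀ {y x e} → Spoke y x → y ~ e → ¬ v ∈ᵉ e → x ∈ᵉ e
  spoke-neighbour-tip s (_ , _ , _ , shared) v∉e with SharesEndpoint⇒∈ᵉ shared
  ... | w , w∈y , w∈e with Joins-∈ᵉ⁻ (joins s) w∈y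
  ... | inj₁ refl = ⊥-elim (v∉e w∈e)
  ... | inj₂ refl = w∈e

  -- neither endpoint of y has degree 1: v is adjacent to u and x, and x to v and t
  spoke-not-root : ∀ {y x t} → Spoke y x → adj F x t ≡ true → t ≢ v → y ∉ R
  spoke-not-root s xt t≢v y∈R with IsPendant-Joins F (lookup pendant y∈R) (joins s)
  ... | inj₁ deg-v≡1 = x≢u s (sym (degree≡1⇒unique-neighbour F deg-v≡1
                                      (IsEdge-adj F r-edge (Joins-sym r-joins)) (IsEdge-adj F (edge s) (joins s))))
  ... | inj₂ deg-x≡1 = t≢v (sym (degree≡1⇒unique-neighbour F deg-x≡1
                                      (IsEdge-adj F (edge s) (Joins-sym (joins s))) xt))

  v∈root-part-member : ∀ {P w} → P ∈ D → r ∈ₚ P → w ∈ₚ P → v ∈ᵉ w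
  v∈root-part-member {w = w} P∈D r∈P w∈P with w ≟ₚ r
  ... | yes refl = Joins-∈ᵉ (Joins-sym r-joins)
  ... | no w≢r   =
    Joins-∈ᵉ (joins (proj₂ (neighbour-spoke (members-adjacent P∈D r∈P w∈P (w≢r ∘ sym)))))

  record CrossTriangle (y z : Pair n) (xy xz : Fin n) : Set where
    field
      part        : Part (Pair n)
      part∈D      : part ∈ D
      third       : Pair n
      triangle    : Triangle part y z third
      third-joins : Joins third xy xz

  open CrossTriangle

  CrossTriangle-sym : ∀ {y z xy xz} → CrossTriangle y z xy xz → CrossTriangle z y xz xy
  CrossTriangle-sym X = record
    { part∈D = part∈D X ; triangle = Triangle-swap₁₂ (triangle X) ; third-joins = Joins-sym (third-joins X) }

  module Split (parts : TwoPartsAt r) where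

    open TwoPartsAt parts

    meet-at-root : ∀ {w} → w ∈ₚ T₁ → w ∈ₚ T₂ → w ≡ r
    meet-at-root {w} w∈T₁ w∈T₂ = decidable-stable (w ≟ₚ r) λ w≢r →
      T₁≢T₂ (same-part T₁∈D T₂∈D w≢r w∈T₁ x∈T₁ w∈T₂ x∈T₂)

    at-v⇒in-root-part : ∀ {e} → IsEdge F e → v ∈ᵉ e → e ∈ₚ T₁ ⊎ e ∈ₚ T₂
    at-v⇒in-root-part {e} e-edge v∈e with e ≟ₚ r
    ... | yes refl = inj₁ x∈T₁
    ... | no e≢r
      with covered (r-edge , e-edge , e≢r ∘ sym , ∈ᵉ⇒SharesEndpoint (Joins-∈ᵉ (Joins-sym r-joins)) v∈e)
    ... | P , P∈D , r∈P , e∈P with only P∈D r∈P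
    ... | inj₁ refl = inj₁ e∈P
    ... | inj₂ refl = inj₂ e∈P

    across-≢ : ∀ {y z} → y ∈ₚ T₁ → y ≢ r → z ∈ₚ T₂ → y ≢ z
    across-≢ y∈T₁ y≢r z∈T₂ refl = y≢r (meet-at-root y∈T₁ z∈T₂)

    third-avoids-v : ∀ {P y z e} → P ∈ D → Triangle P y z e →
                     y ∈ₚ T₁ → y ≢ r → z ∈ₚ T₂ → z ≢ r → ¬ v ∈ᵉ e
    third-avoids-v {e = e} P∈D t y∈T₁ y≢r z∈T₂ z≢r v∈e =
      [ e∉T₁ , e∉T₂ ]′ (at-v⇒in-root-part (~-edgeʳ x~z) v∈e)
      where
      open Triangle t
      e∉T₁ : ¬ e ∈ₚ T₁
      e∉T₁ e∈T₁ = z≢r (meet-at-root (subst (_ ∈ₚ_) P≡T₁ y∈P) z∈T₂)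
        where P≡T₁ = same-part P∈D T₁∈D (~-≢ x~z) x∈P z∈P y∈T₁ e∈T₁
      e∉T₂ : ¬ e ∈ₚ T₂
      e∉T₂ e∈T₂ = y≢r (meet-at-root y∈T₁ (subst (_ ∈ₚ_) P≡T₂ x∈P))
        where P≡T₂ = same-part P∈D T₂∈D (~-≢ y~z) y∈P z∈P z∈T₂ e∈T₂

    cross-triangle : ∀ {y z xy xz} → y ∈ₚ T₁ → y ≢ r → Spoke y xy →
                     z ∈ₚ T₂ → z ≢ r → Spoke z xz → CrossTriangle y z xy xz
    cross-triangle y∈T₁ y≢r sy z∈T₂ z≢r sz
      with y≢z ← across-≢ y∈T₁ y≢r z∈T₂
      with covered (spokes-adjacent sy sz y≢z)
    ... | P , P∈D , y∈P , z∈P with triangle-through P∈D y∈P z∈P y≢z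
    ... | e , t = record
      { part∈D = P∈D ; triangle = t
      ; third-joins = ∈ᵉ-Joins (tip∈e sy x~z) (tip∈e sz y~z) (spokes-distinct-tips sy sz y≢z)
      }
      where
      open Triangle t
      tip∈e : ∀ {w x} → Spoke w x → w ~ e → x ∈ᵉ e
      tip∈e s w~e = spoke-neighbour-tip s w~e (third-avoids-v P∈D t y∈T₁ y≢r z∈T₂ z≢r)

    cross-part≢T₁ : ∀ {y z xy xz} (X : CrossTriangle y z xy xz) → z ∈ₚ T₂ → z ≢ r → part X ≢ T₁
    cross-part≢T₁ X z∈T₂ z≢r X≡T₁ =
      z≢r (meet-at-root (subst (_ ∈ₚ_) X≡T₁ (Triangle.y∈P (triangle X))) z∈T₂)

    cross-parts-≢ : ∀ {y z z′ xy xz xz′}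
                    (X : CrossTriangle y z xy xz) (X′ : CrossTriangle y z′ xy xz′) →
                    y ∈ₚ T₁ → y ≢ r → z ∈ₚ T₂ → z′ ∈ₚ T₂ → z ≢ z′ →
                    part X ≢ part X′
    cross-parts-≢ X X′ y∈T₁ y≢r z∈T₂ z′∈T₂ z≢z′ X≡X′ =
      y≢r (meet-at-root y∈T₁ (subst (_ ∈ₚ_) X≡T₂ (Triangle.x∈P (triangle X))))
      where
      z′∈X = subst (_ ∈ₚ_) (sym X≡X′) (Triangle.y∈P (triangle X′))
      X≡T₂ = same-part (part∈D X) T₂∈D z≢z′ (Triangle.y∈P (triangle X)) z′∈X z∈T₂ z′∈T₂

    spoke-parts : ∀ {y z z′ xy xz xz′} → y ∈ₚ T₁ → y ≢ r → Spoke y xy →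
                  Triangle T₂ r z z′ → Spoke z xz →
                  (X : CrossTriangle y z xy xz) (X′ : CrossTriangle y z′ xy xz′) →
                  Exhausts y (T₁ ∷ part X ∷ part X′ ∷ [])
    spoke-parts y∈T₁ y≢r sy t₂ sz X X′ =
      saturated⇒Exhausts (nonRoot3 _ (edge sy) y∉R)
        ((T₁≢X ∷ T₁≢X′ ∷ []) ∷ (X≢X′ ∷ []) ∷ [] ∷ [])
        ((T₁∈D , y∈T₁) ∷ (part∈D X , x∈P (triangle X))
                       ∷ (part∈D X′ , x∈P (triangle X′)) ∷ [])
      where
      open Triangle
      y∉R = spoke-not-root sy (IsEdge-adj F (~-edgeʳ (x~z (triangle X))) (third-joins X))
                              (tip≢v sz)
      T₁≢X  = cross-part≢T₁ X  (y∈P t₂) (~-≢ (x~y t₂) ∘ sym) ∘ sym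
      T₁≢X′ = cross-part≢T₁ X′ (z∈P t₂) (~-≢ (x~z t₂) ∘ sym) ∘ sym
      X≢X′  = cross-parts-≢ X X′ y∈T₁ y≢r (y∈P t₂) (z∈P t₂) (~-≢ (y~z t₂))

  module Configuration (parts : TwoPartsAt r) {a b c d xa xb xc xd}
                       (t₁ : Triangle (TwoPartsAt.T₁ parts) r a b) (t₂ : Triangle (TwoPartsAt.T₂ parts) r c d)
                       (sa : Spoke a xa) (sb : Spoke b xb) (sc : Spoke c xc) (sd : Spoke d xd) where

    open TwoPartsAt parts
    open Split parts
    module Swapped = Split (TwoPartsAt-swap parts)
    open Triangle

    a≢r : a ≢ r
    a≢r = ~-≢ (x~y t₁) ∘ sym
    b≢r : b ≢ r
    b≢r = ~-≢ (x~z t₁) ∘ sym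
    c≢r : c ≢ r
    c≢r = ~-≢ (x~y t₂) ∘ sym
    d≢r : d ≢ r
    d≢r = ~-≢ (x~z t₂) ∘ sym

    xc≢xd : xc ≢ xd
    xc≢xd = spokes-distinct-tips sc sd (~-≢ (y~z t₂))
    xb≢xd : xb ≢ xd
    xb≢xd = spokes-distinct-tips sb sd (across-≢ (z∈P t₁) b≢r (z∈P t₂))

    -- parameters rather than definitions, so that type checking never unfolds them
    module _ (Xac : CrossTriangle a c xa xc) (Xad : CrossTriangle a d xa xd) (Xbc : CrossTriangle b c xb xc) where

      a-parts : Exhausts a (T₁ ∷ part Xac ∷ part Xad ∷ [])
      a-parts = spoke-parts (y∈P t₁) a≢r sa t₂ sc Xac Xad
      c-parts : Exhausts c (T₂ ∷ part Xac ∷ part Xbc ∷ [])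
      c-parts = Swapped.spoke-parts (y∈P t₂) c≢r sc t₁ sa (CrossTriangle-sym Xac) (CrossTriangle-sym Xbc)

      e₁ e₂ : Pair n
      e₁ = third Xac
      e₂ = third Xad

      e₁~e₂ : e₁ ~ e₂
      e₁~e₂ = ~-edgeʳ (x~z (triangle Xac)) , ~-edgeʳ (x~z (triangle Xad))
            , (λ e₁≡e₂ → xc≢xd (Joins-injʳ (third-joins Xac)
                                             (subst (λ e → Joins e xa xd) (sym e₁≡e₂) (third-joins Xad))))
            , ∈ᵉ⇒SharesEndpoint (Joins-∈ᵉ (third-joins Xac)) (Joins-∈ᵉ (third-joins Xad))

      module _ {Q q} (Q∈D : Q ∈ D) (tQ : Triangle Q e₁ e₂ q) where

        q-edge : IsEdge F q
        q-edge = ~-edgeʳ (x~z tQ)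

        -- a lies in both cross parts at a, so if it were in Q, Q would equal both
        a∉Q : ¬ a ∈ₚ Q
        a∉Q a∈Q = cross-parts-≢ Xac Xad (y∈P t₁) a≢r (y∈P t₂) (z∈P t₂) (~-≢ (y~z t₂))
                                (trans Xac≡Q (sym Xad≡Q))
          where
          Xac≡Q = same-part (part∈D Xac) Q∈D (~-≢ (x~z (triangle Xac)))
                            (x∈P (triangle Xac)) (z∈P (triangle Xac)) a∈Q (x∈P tQ)
          Xad≡Q = same-part (part∈D Xad) Q∈D (~-≢ (x~z (triangle Xad)))
                            (x∈P (triangle Xad)) (z∈P (triangle Xad)) a∈Q (y∈P tQ)

        q∉Xac : ¬ q ∈ₚ part Xac
        q∉Xac q∈Xac = a∉Q (subst (a ∈ₚ_) Xac≡Q (x∈P (triangle Xac)))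
          where
          Xac≡Q = same-part (part∈D Xac) Q∈D (~-≢ (x~z tQ) ∘ sym)
                            q∈Xac (z∈P (triangle Xac)) (z∈P tQ) (x∈P tQ)

        a≢q : a ≢ q
        a≢q refl = a∉Q (z∈P tQ)

        q∌xa : ¬ xa ∈ᵉ q
        q∌xa xa∈q = case neighbour-in-some-part a-parts a~q of λ where
            (here q∈T₁)                  → a≢q (sym (spoke-unique sa q-edge (q-joins q∈T₁)))
            (there (here q∈Xac))         → q∉Xac q∈Xac
            (there (there (here q∈Xad))) → a∉Q (subst (a ∈ₚ_) (Xad≡Q q∈Xad) (x∈P (triangle Xad)))
          where
          a~q : a ~ q
          a~q = edge sa , q-edge , a≢q , ∈ᵉ⇒SharesEndpoint (Joins-∈ᵉ (Joins-sym (joins sa))) xa∈q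
          q-joins : q ∈ₚ T₁ → Joins q v xa
          q-joins q∈T₁ = ∈ᵉ-Joins (v∈root-part-member T₁∈D x∈T₁ q∈T₁) xa∈q (tip≢v sa ∘ sym)
          Xad≡Q : q ∈ₚ part Xad → part Xad ≡ Q
          Xad≡Q q∈Xad = same-part (part∈D Xad) Q∈D (~-≢ (y~z tQ) ∘ sym)
                                  q∈Xad (z∈P (triangle Xad)) (z∈P tQ) (y∈P tQ)

        ¬q-joins-xc-xd : ¬ Joins q xc xd
        ¬q-joins-xc-xd q-joins = case neighbour-in-some-part c-parts c~q of λ where
            (here q∈T₂)                  → v∉q (v∈root-part-member T₂∈D x∈T₂ q∈T₂)
            (there (here q∈Xac))         → q∉Xac q∈Xac
            (there (there (here q∈Xbc))) → case members (triangle Xbc) q∈Xbc of λ where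
              (inj₁ refl)        → v∉q (Joins-∈ᵉ (joins sb))
              (inj₂ (inj₁ refl)) → v∉q (Joins-∈ᵉ (joins sc))
              (inj₂ (inj₂ refl)) → xb≢xd (Joins-injʳ (Joins-sym (third-joins Xbc)) q-joins)
          where
          v∉q : ¬ v ∈ᵉ q
          v∉q v∈q = [ tip≢v sc ∘ sym , tip≢v sd ∘ sym ]′ (Joins-∈ᵉ⁻ q-joins v∈q)
          c~q : c ~ q
          c~q = edge sc , q-edge , (λ c≡q → v∉q (subst (v ∈ᵉ_) c≡q (Joins-∈ᵉ (joins sc))))
              , ∈ᵉ⇒SharesEndpoint (Joins-∈ᵉ (Joins-sym (joins sc))) (Joins-∈ᵉ q-joins)

        no-third-vertex : ⊥
        no-third-vertex = [ q∌xa , ¬q-joins-xc-xd ]′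
          (meets-cherry (third-joins Xac) (third-joins Xad) xc≢xd
                        (~-shares (~-sym (x~z tQ))) (~-shares (~-sym (y~z tQ))))

      no-cross-configuration : ⊥
      no-cross-configuration with covered e₁~e₂
      ... | Q , Q∈D , e₁∈Q , e₂∈Q =
        no-third-vertex Q∈D (proj₂ (triangle-through Q∈D e₁∈Q e₂∈Q (~-≢ e₁~e₂)))

    impossible : ⊥
    impossible = no-cross-configuration
      (cross-triangle (y∈P t₁) a≢r sa (y∈P t₂) c≢r sc)
      (cross-triangle (y∈P t₁) a≢r sa (z∈P t₂) d≢r sd)
      (cross-triangle (z∈P t₁) b≢r sb (y∈P t₂) c≢r sc)

  impossible : ⊥
  impossible with parts ← two-parts-at (root2 r r-edge r∈R)
    with triangle-at (TwoPartsAt.T₁∈D parts) (TwoPartsAt.x∈T₁ parts)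
       | triangle-at (TwoPartsAt.T₂∈D parts) (TwoPartsAt.x∈T₂ parts)
  ... | a , b , t₁ | c , d , t₂
    with neighbour-spoke (Triangle.x~y t₁) | neighbour-spoke (Triangle.x~z t₁)
       | neighbour-spoke (Triangle.x~y t₂) | neighbour-spoke (Triangle.x~z t₂)
  ... | _ , sa | _ , sb | _ , sc | _ , sd = Configuration.impossible parts t₁ t₂ sa sb sc sd

edge-part? : ∀ {V : Set} (D : List (Part V)) → Dec (∃[ x ] ∃[ y ] edgeP x y ∈ D)
edge-part? []               = no λ ()
edge-part? (edgeP x y ∷ D)  = yes (x , y , here refl)
edge-part? (triP _ _ _ ∷ D) = map′ (λ (x , y , x-y∈D) → x , y , there x-y∈D)
                                   (λ { (x , y , there x-y∈D) → x , y , x-y∈D })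
                                   (edge-part? D)

lemma4p6 : ∀ {n} (F : SimpleGraph n) (R : List (Pair n)) →
           All (IsPendant F) R → R ≢ [] →
           (D : List (Part (Pair n))) → ValidDecomposition F R D →
           ∃[ x ] ∃[ y ] (edgeP x y ∈ D)
lemma4p6 F []      _       R≢[] D valid = ⊥-elim (R≢[] refl)
lemma4p6 F (r ∷ R) pendant _ D valid with lookup pendant (here refl)
... | r-pendant@(r-edge , _) with pendant-endpoint F r-pendant
... | u , v , r-joins , deg-u≡1 = decidable-stable (edge-part? D) λ no-edge-part →
  PendantRoot.impossible pendant valid (λ x-y∈D → no-edge-part (_ , _ , x-y∈D))
                         (here refl) r-edge r-joins deg-u≡1
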